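{- Let $G$ be a $3K_1$-free graph. If $G$ is not co-bipartite, then $G^2$ is a complete graph.
   Context: Graphs are finite, simple, undirected. $G$ is $3K_1$-free if it has no independent set of size $3$. $G$ is co-bipartite if its complement is bipartite (equivalently, $V(G)$ can be partitioned into two cliques). The square $G^2$ has vertex set $V(G)$ and $uv\in E(G^2)$ iff $1\le d_G(u,v)\leq 2$. -}

module Defs where

open import Data.Nat using (ℕ)
open import Data.Fin using (Fin)
open import Data.Bool using (Bool)
open import Data.Product using (Σ; ∃; _×_)
open import Data.Sum using (_⊎_)
open import Relation.Nullary using (¬_; Dec)
open import Relation.Binary.PropositionalEquality using (_≡_)
open import Level using (0ℓ; suc)

record Graph (n : ℕ) : Set₁ where
  field
    Adj     : Fin n → Fin n → Set
    adj?    : ∀ u v → Dec (Adj u v)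
    sym     : ∀ {u v} → Adj u v → Adj v u
    irrefl  : ∀ {u} → ¬ Adj u u
open Graph public

ThreeK1Free : ∀ {n} → Graph n → Set
ThreeK1Free {n} G = (x y z : Fin n) → ¬ x ≡ y → ¬ y ≡ z → ¬ x ≡ z →
  ¬ (¬ Adj G x y × ¬ Adj G y z × ¬ Adj G x z)

CoBipartite : ∀ {n} → Graph n → Set
CoBipartite {n} G = Σ (Fin n → Bool) λ c →
  (u v : Fin n) → ¬ u ≡ v → c u ≡ c v → Adj G u v

SqAdj : ∀ {n} → Graph n → Fin n → Fin n → Set
SqAdj {n} G u v = ¬ u ≡ v × (Adj G u v ⊎ ∃ λ (w : Fin n) → Adj G u w × Adj G w v)

IsComplete : ∀ {n} → (Fin n → Fin n → Set) → Set
IsComplete {n} R = (u v : Fin n) → ¬ u ≡ v → R u v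

-- If u and v are at distance at least 3, then 3K₁-freeness forces every vertex
-- into N[u] or N[v] (else u, v, w is independent), and each closed neighbourhood
-- is a clique (two non-adjacent neighbours of u would be independent together
-- with v). So a graph whose square is not complete is covered by two cliques.
module Submission where

open import Defs
open import Data.Nat using (ℕ)
open import Data.Fin using (Fin; _≟_)
open import Data.Fin.Properties using (any?)
open import Data.Product using (_×_; _,_)
open import Data.Sum using (_⊎_; inj₁; inj₂)
open import Data.Empty using (⊥-elim)
open import Relation.Nullary using (¬_; yes; no; does)
open import Relation.Nullary.Decidable using (_×-dec_; _⊎-dec_)
open import Relation.Unary using (Pred; Decidable)
open import Relation.Binary.PropositionalEquality using (_≡_; refl; _≢_; ≢-sym)
open import Level using (0ℓ)

module _ {n : ℕ} (G : Graph n) where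

  ClosedNbhd : Fin n → Pred (Fin n) 0ℓ
  ClosedNbhd u w = w ≡ u ⊎ Adj G u w

  IsClique : Pred (Fin n) 0ℓ → Set
  IsClique P = ∀ x y → x ≢ y → P x → P y → Adj G x y

  FarApart : Fin n → Fin n → Set
  FarApart u v = u ≢ v × ¬ Adj G u v × (∀ w → Adj G u w → ¬ Adj G w v)

  farApart-sym : ∀ {u v} → FarApart u v → FarApart v u
  farApart-sym (u≢v , ¬uv , noCommon) =
    ≢-sym u≢v , (λ vu → ¬uv (sym G vu)) , λ w vw wu → noCommon w (sym G wu) (sym G vw)

  sqAdj⊎farApart : ∀ {u v} → u ≢ v → SqAdj G u v ⊎ FarApart u v
  sqAdj⊎farApart {u} {v} u≢v with adj? G u v
  ... | yes uv = inj₁ (u≢v , inj₁ uv)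
  ... | no ¬uv with any? (λ w → adj? G u w ×-dec adj? G w v)
  ...   | yes common = inj₁ (u≢v , inj₂ common)
  ...   | no ¬common = inj₂ (u≢v , ¬uv , λ w uw wv → ¬common (w , uw , wv))

  twoCliques⇒coBipartite : ∀ {P Q : Pred (Fin n) 0ℓ} → Decidable P →
    IsClique P → IsClique Q → (∀ w → ¬ P w → Q w) → CoBipartite G
  twoCliques⇒coBipartite {P} {Q} P? cliqueP cliqueQ cover = (λ w → does (P? w)) , colourClique
    where
    colourClique : ∀ x y → x ≢ y → does (P? x) ≡ does (P? y) → Adj G x y
    colourClique x y x≢y same with P? x | P? y | same
    ... | yes px | yes py | _ = cliqueP x y x≢y px py
    ... | no ¬px | no ¬py | _ = cliqueQ x y x≢y (cover x ¬px) (cover y ¬py)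
    ... | yes _  | no _   | ()
    ... | no _   | yes _  | ()

  module _ (free : ThreeK1Free G) where

    closedNbhd-isClique : ∀ {u v} → FarApart u v → IsClique (ClosedNbhd u)
    closedNbhd-isClique _ x y x≢y (inj₁ refl) (inj₁ refl) = ⊥-elim (x≢y refl)
    closedNbhd-isClique _ x y x≢y (inj₁ refl) (inj₂ xy) = xy
    closedNbhd-isClique _ x y x≢y (inj₂ yx) (inj₁ refl) = sym G yx
    closedNbhd-isClique {u} {v} (_ , ¬uv , noCommon) x y x≢y (inj₂ ux) (inj₂ uy)
      with adj? G x y
    ... | yes xy = xy
    ... | no ¬xy = ⊥-elim (free x y v x≢y (≢v uy) (≢v ux) (¬xy , noCommon y uy , noCommon x ux))
      where
      ≢v : ∀ {w} → Adj G u w → w ≢ v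
      ≢v uw refl = ¬uv uw

    closedNbhds-cover : ∀ {u v} → FarApart u v → ∀ w → ¬ ClosedNbhd u w → ClosedNbhd v w
    closedNbhds-cover {u} {v} (u≢v , ¬uv , _) w w∉N[u] with w ≟ v | adj? G v w
    ... | yes w≡v | _      = inj₁ w≡v
    ... | no _    | yes vw = inj₂ vw
    ... | no w≢v  | no ¬vw =
      ⊥-elim (free u v w u≢v (≢-sym w≢v) (λ { refl → w∉N[u] (inj₁ refl) })
                   (¬uv , ¬vw , λ uw → w∉N[u] (inj₂ uw)))

    farApart⇒coBipartite : ∀ {u v} → FarApart u v → CoBipartite G
    farApart⇒coBipartite {u} far =
      twoCliques⇒coBipartite (λ w → (w ≟ u) ⊎-dec adj? G u w)
        (closedNbhd-isClique far) (closedNbhd-isClique (farApart-sym far))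
        (closedNbhds-cover far)

lemma5 : (n : ℕ) (G : Graph n) → ThreeK1Free G → ¬ CoBipartite G →
    IsComplete (SqAdj G)
lemma5 n G free notCoBipartite u v u≢v with sqAdj⊎farApart G u≢v
... | inj₁ sqAdj = sqAdj
... | inj₂ far   = ⊥-elim (notCoBipartite (farApart⇒coBipartite G free far))
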